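{- Let $\mathbf{u}=(u_0,\ldots,u_{N+M-1})$ be an admissible sequence, $\bm{v}=(u_1,\ldots,u_{N+M-1},1)$, $\bm{v}'=(u_1,\ldots,u_{N+M-1},0)$. Then $$\hat P_{\mathbf{u}}=\begin{cases} q(P_{\bm{v}}+P_{\bm{v}'}),& u_0=u_N=u_M=0,\\ qP_{\bm{v}},& u_0=0 \text{ and } u_N+u_M=1,\\ q(1+at^{\lambda(\bm{v})})P_{\bm{v}},& u_0=0\text{ and } u_N=u_M=1,\\ t^{\lambda(\mathbf{u})}P_{\bm{v}},& u_0=u_N=u_M=1.\end{cases}$$
   Context: Let $M,N$ be positive integers, $I_{M,N}$ the set of subsets $\Delta\subset\mathbb{Z}_{\ge0}$ with $\Delta+N\subset\Delta$, $\Delta+M\subset\Delta$ and finite complement $\overline{\Delta}$. For $\mathbf{u}\in\{0,1\}^{N+M}$, $I_{\mathbf{u}}=\{\Delta\in I_{M,N}:\forall\,0\le i<N+M,\ i\in\Delta\Leftrightarrow u_i=1\}$, admissible means $I_{\mathbf{u}}\ne\emptyset$, $\lambda(\mathbf{u})=\sum_{i=0}^{M-1}(u_{i+N}-u_i)$, and $P_{\mathbf{u}}=\sum_{\Delta\in I_{\mathbf{u}}}q^{\mathrm{area}(\Delta)}t^{\mathrm{codinv}(\Delta)}$ (area = number of gaps; codinv $=\sum_a\sharp([a,a+M-1]\cap\overline{\Delta})$ over $N$-generators $a$, i.e. $a\in\Delta$, $a-N\notin\Delta$). A double cogenerator of $\Delta$ is $k\in\overline{\Delta}$ with $k+N,k+M\in\Delta$;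 $\lambda_k(\Delta)$ is the number of $N$-generators of $\Delta$ in $[k+N+1,k+N+M]$. $\hat P_{\mathbf{u}}(q,t,a)=\sum_{\Delta\in I_{\mathbf{u}}}q^{\mathrm{area}(\Delta)}t^{\mathrm{codinv}(\Delta)}\prod_{k\text{ double cogenerator}}(1+at^{\lambda_k(\Delta)})$. -}

module Defs where

open import Data.Bool using (Bool; true; false; not; _∧_; _∨_; if_then_else_)
open import Data.Nat using (ℕ; zero; suc; _+_; _*_; _∸_; _<ᵇ_; _≡ᵇ_)
open import Data.Integer using (ℤ; +_; _-_)
import Data.Integer as ℤ
open import Data.List using (List; []; _∷_; map; _++_; upTo; length)
open import Data.Nat.ListAction using (sum)
open import Data.Product using (_×_; _,_; Σ)
open import Relation.Nullary using (does)
open import Relation.Binary.PropositionalEquality using (_≡_)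

bit : Bool → ℕ
bit true  = 1
bit false = 0

eqB : Bool → Bool → Bool
eqB true  b = b
eqB false b = not b

allB : List ℕ → (ℕ → Bool) → Bool
allB []       p = true
allB (x ∷ xs) p = p x ∧ allB xs p

countB : {A : Set} → List A → (A → Bool) → ℕ
countB []       p = 0
countB (x ∷ xs) p = bit (p x) + countB xs p

filterB : List ℕ → (ℕ → Bool) → List ℕ
filterB []       p = []
filterB (x ∷ xs) p = if p x then x ∷ filterB xs p else filterB xs p

lookupD : List Bool → Bool → ℕ → Bool
lookupD []       b k       = b
lookupD (x ∷ xs) b zero    = x
lookupD (x ∷ xs) b (suc k) = lookupD xs b k

-- ## Representation of Δ
-- A subset Δ ⊆ ℤ≥0 with finite complement is represented by a finite list
-- d of booleans: k ∈ Δ iff (d_k = true) for k < length d, and every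
-- k ≥ length d lies in Δ.

inD : List Bool → ℕ → Bool
inD d k = lookupD d true k

isGap : List Bool → ℕ → Bool
isGap d k = not (inD d k)

-- Δ + N ⊆ Δ and Δ + M ⊆ Δ (for k ≥ length d both sides are automatic)
validB : ℕ → ℕ → List Bool → Bool
validB N M d = allB (upTo (length d))
  (λ k → isGap d k ∨ (inD d (k + N) ∧ inD d (k + M)))

matchesB : ℕ → ℕ → List Bool → List Bool → Bool
matchesB N M u d = allB (upTo (N + M)) (λ i → eqB (inD d i) (lookupD u false i))

Admissible : ℕ → ℕ → List Bool → Set
Admissible N M u = Σ (List Bool) λ d → (validB N M d ≡ true) × (matchesB N M u d ≡ true)

area : List Bool → ℕ
area d = countB (upTo (length d)) (isGap d)

isNGen : ℕ → List Bool → ℕ → Bool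
isNGen N d a = inD d a ∧ (if a <ᵇ N then true else isGap d (a ∸ N))

-- codinv = Σ over N-generators a of #([a, a+M-1] ∩ gaps)
-- (every N-generator is < length d + N)
codinv : ℕ → ℕ → List Bool → ℕ
codinv N M d = sum (map
  (λ a → if isNGen N d a then countB (map (λ x → a + x) (upTo M)) (isGap d) else 0)
  (upTo (length d + N)))

dcogens : ℕ → ℕ → List Bool → List ℕ
dcogens N M d = filterB (upTo (length d))
  (λ k → isGap d k ∧ (inD d (k + N) ∧ inD d (k + M)))

lamk : ℕ → ℕ → List Bool → ℕ → ℕ
lamk N M d k = countB (map (λ x → k + N + 1 + x) (upTo M)) (isNGen N d)

-- monomials (t-exponent, a-exponent) of Π_{λ ∈ ls} (1 + a t^λ)
expandProd : List ℕ → List (ℕ × ℕ)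
expandProd []       = (0 , 0) ∷ []
expandProd (l ∷ ls) = let r = expandProd ls in
  r ++ map (λ { (x , y) → (x + l , suc y) }) r

eqℤ : ℤ → ℤ → Bool
eqℤ i j = does (i ℤ.≟ j)

-- coefficient of t^i a^j in t^codinv(Δ) Π_k (1 + a t^{λ_k(Δ)})
termCoef : ℕ → ℕ → List Bool → ℤ → ℕ → ℕ
termCoef N M d i j = countB (expandProd (map (lamk N M d) (dcogens N M d)))
  (λ { (x , y) → eqℤ (+ (codinv N M d + x)) i ∧ (y ≡ᵇ j) })

-- ## Formal series in q, t^{±1}, a with ℕ coefficients
-- X n i j = coefficient of q^n t^i a^j

Series : Set
Series = ℕ → ℤ → ℕ → ℕ

_≈S_ : Series → Series → Set
X ≈S Y = ∀ n i j → X n i j ≡ Y n i j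

_⊕_ : Series → Series → Series
(X ⊕ Y) n i j = X n i j + Y n i j

qmul : Series → Series
qmul X zero    i j = 0
qmul X (suc n) i j = X n i j

tmul : ℤ → Series → Series
tmul l X n i j = X n (i - l) j

amul : Series → Series
amul X n i zero    = 0
amul X n i (suc j) = X n i j

allBits : ℕ → List (List Bool)
allBits zero    = [] ∷ []
allBits (suc L) = map (true ∷_) (allBits L) ++ map (false ∷_) (allBits L)

-- A Δ ∈ I_{M,N} of area n has all its gaps < n * N (if g is a gap,
-- so are g - N, g - 2N, …, hence ⌊g/N⌋ + 1 ≤ n), so Δ is represented
-- uniquely by a list of length n * N; we enumerate those.
Phat : ℕ → ℕ → List Bool → Series
Phat N M u n i j = sum (map
  (λ d → if validB N M d ∧ (matchesB N M u d ∧ (area d ≡ᵇ n))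
         then termCoef N M d i j else 0)
  (allBits (n * N)))

sumℤ : List ℤ → ℤ
sumℤ []       = + 0
sumℤ (x ∷ xs) = x ℤ.+ sumℤ xs

lambdaSeq : ℕ → ℕ → List Bool → ℤ
lambdaSeq N M u = sumℤ
  (map (λ i → + bit (lookupD u false (i + N)) - + bit (lookupD u false i)) (upTo M))

module Submission where

-- Shift Δ down: Δ′ = {k ∣ k + 1 ∈ Δ} is again closed under + N and + M, and Δ ∈ I_u iff Δ′ lies in
-- I_v or I_v′, the last entry of v being forced to 1 as soon as N or M lies in Δ. If 0 ∉ Δ, the area
-- drops by one, codinv is unchanged, and the double cogenerators of Δ are those of Δ′ shifted by one,
-- plus 0 exactly when N, M ∈ Δ, with λ₀(Δ) = λ(v). If 0 ∈ Δ (so N, M ∈ Δ), area and double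
-- cogenerators are unchanged, while the N-generator N − 1 of Δ′ is traded for the N-generator 0 of Δ,
-- which raises codinv by λ(u).
-- Since Phat enumerates bit lists of one fixed length, the bijection Δ ↔ Δ′ needs padding invariance:
-- appending true's does not change Δ, and a list with a gap beyond area · N is never counted.

open import Defs
open import Data.Bool using (Bool; true; false; not; _∧_; _∨_; if_then_else_; T)
open import Data.Bool.Properties using (∧-zeroʳ; ∧-identityʳ)
open import Data.Unit using (tt)
open import Data.Nat using (ℕ; zero; suc; _+_; _*_; _∸_; _≤_; _<_; z≤n; s≤s; _<ᵇ_; _≡ᵇ_)
open import Data.Nat.Properties
open import Data.Integer using (ℤ; +_; _-_)
import Data.Integer as ℤ
import Data.Integer.Properties as ℤ
open import Data.Integer.Tactic.RingSolver using (solve-∀)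
open import Data.List using (List; []; _∷_; _++_; drop; length; map; upTo; replicate; [_])
open import Data.List.Properties using (map-++; map-∘; map-cong; upTo-∷ʳ; map-upTo; length-++; length-replicate)
open import Data.Nat.ListAction using (sum)
open import Data.Nat.ListAction.Properties using (sum-++)
open import Data.Product using (_×_; _,_; Σ; proj₁; proj₂)
open import Data.Empty using (⊥-elim)
open import Data.Sum using (_⊎_; inj₁; inj₂)
import Data.Sum as Sum
open import Function using (_∘_)
open import Relation.Binary.PropositionalEquality hiding ([_])
open import Relation.Nullary using (yes; no)
open import Relation.Binary.Definitions using (tri<; tri≈; tri>)

ExactlyOne : Bool → Bool → Set
ExactlyOne a b = (a ≡ true × b ≡ false) ⊎ (a ≡ false × b ≡ true)

∧≡true : ∀ {a b} → a ∧ b ≡ true → (a ≡ true) × (b ≡ true)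
∧≡true {true} {true} _ = refl , refl

eqB≡true : ∀ {a b} → eqB a b ≡ true → a ≡ b
eqB≡true {true}  {true}  _ = refl
eqB≡true {false} {false} _ = refl

false≢true : false ≢ true
false≢true ()

upTo-suc : ∀ n → upTo (suc n) ≡ 0 ∷ map suc (upTo n)
upTo-suc n = cong (0 ∷_) (sym (map-upTo suc n))

sum-map-++ : ∀ {A : Set} (f : A → ℕ) xs ys → sum (map f (xs ++ ys)) ≡ sum (map f xs) + sum (map f ys)
sum-map-++ f xs ys = trans (cong sum (map-++ f xs ys)) (sum-++ (map f xs) (map f ys))

sum-map-cong : ∀ {A : Set} {f g : A → ℕ} → (∀ x → f x ≡ g x) → ∀ xs → sum (map f xs) ≡ sum (map g xs)
sum-map-cong f≗g xs = cong sum (map-cong f≗g xs)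

sum-map-zero : ∀ {A : Set} (f : A → ℕ) → (∀ x → f x ≡ 0) → ∀ xs → sum (map f xs) ≡ 0
sum-map-zero f f≗0 []       = refl
sum-map-zero f f≗0 (x ∷ xs) = cong₂ _+_ (f≗0 x) (sum-map-zero f f≗0 xs)

sum-map-+ : ∀ {A : Set} (f g : A → ℕ) xs → sum (map (λ x → f x + g x) xs) ≡ sum (map f xs) + sum (map g xs)
sum-map-+ f g []       = refl
sum-map-+ f g (x ∷ xs) rewrite sum-map-+ f g xs = +-exch (f x) (g x) (sum (map f xs)) (sum (map g xs))
  where
  +-exch : ∀ a b c d → a + b + (c + d) ≡ a + c + (b + d)
  +-exch a b c d rewrite +-assoc a b (c + d) | +-assoc a c (b + d)
    | sym (+-assoc b c d) | +-comm b c | +-assoc c b d = refl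

sum-upTo-last : ∀ (f : ℕ → ℕ) n → sum (map f (upTo (suc n))) ≡ sum (map f (upTo n)) + f n
sum-upTo-last f n = begin
  sum (map f (upTo (suc n)))             ≡⟨ cong (sum ∘ map f) (sym (upTo-∷ʳ n)) ⟩
  sum (map f (upTo n ++ [ n ]))          ≡⟨ sum-map-++ f (upTo n) [ n ] ⟩
  sum (map f (upTo n)) + (f n + 0)       ≡⟨ cong (_+_ (sum (map f (upTo n)))) (+-identityʳ (f n)) ⟩
  sum (map f (upTo n)) + f n             ∎
  where open ≡-Reasoning

sum-upTo-head : ∀ (f : ℕ → ℕ) n → sum (map f (upTo (suc n))) ≡ f 0 + sum (map (f ∘ suc) (upTo n))
sum-upTo-head f n = trans (cong (sum ∘ map f) (upTo-suc n)) (cong (λ xs → f 0 + sum xs) (sym (map-∘ (upTo n))))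

sum-upTo-cong : ∀ {f g : ℕ → ℕ} n → (∀ i → i < n → f i ≡ g i) → sum (map f (upTo n)) ≡ sum (map g (upTo n))
sum-upTo-cong zero          f≗g = refl
sum-upTo-cong {f} {g} (suc n) f≗g = begin
  sum (map f (upTo (suc n)))     ≡⟨ sum-upTo-last f n ⟩
  sum (map f (upTo n)) + f n     ≡⟨ cong₂ _+_ (sum-upTo-cong n (λ i i<n → f≗g i (m<n⇒m<1+n i<n))) (f≗g n (n<1+n n)) ⟩
  sum (map g (upTo n)) + g n     ≡⟨ sym (sum-upTo-last g n) ⟩
  sum (map g (upTo (suc n)))     ∎
  where open ≡-Reasoning

sum-upTo-beyond : ∀ (f : ℕ → ℕ) n K → (∀ k → n ≤ k → f k ≡ 0) → sum (map f (upTo (n + K))) ≡ sum (map f (upTo n))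
sum-upTo-beyond f n zero    f≗0 = cong (sum ∘ map f ∘ upTo) (+-identityʳ n)
sum-upTo-beyond f n (suc K) f≗0 rewrite +-suc n K | sum-upTo-last f (n + K) | f≗0 (n + K) (m≤m+n n K) =
  trans (+-identityʳ _) (sum-upTo-beyond f n K f≗0)

sum-upTo-except : ∀ B c (f g : ℕ → ℕ) → c < B → (∀ a → a ≢ c → f a ≡ g a) → f c ≡ 0 →
  sum (map f (upTo B)) + g c ≡ sum (map g (upTo B))
sum-upTo-except (suc B) c f g c<B f≗g fc≡0 with m<1+n⇒m<n∨m≡n c<B
... | inj₁ c<B′ rewrite sum-upTo-last f B | sum-upTo-last g B | f≗g B (λ B≡c → <-irrefl (sym B≡c) c<B′)
  | +-assoc (sum (map f (upTo B))) (g B) (g c) | +-comm (g B) (g c)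
  | sym (+-assoc (sum (map f (upTo B))) (g c) (g B)) = cong (_+ g B) (sum-upTo-except B c f g c<B′ f≗g fc≡0)
... | inj₂ refl rewrite sum-upTo-last f B | sum-upTo-last g B | fc≡0 =
  cong (_+ g B) (trans (+-identityʳ _) (sum-upTo-cong B (λ a a<B → f≗g a (λ a≡B → <-irrefl a≡B a<B))))

countB-sum : ∀ {A : Set} (xs : List A) p → countB xs p ≡ sum (map (bit ∘ p) xs)
countB-sum []       p = refl
countB-sum (x ∷ xs) p = cong (_+_ (bit (p x))) (countB-sum xs p)

countB-++ : ∀ {A : Set} (xs ys : List A) p → countB (xs ++ ys) p ≡ countB xs p + countB ys p
countB-++ xs ys p rewrite countB-sum (xs ++ ys) p | countB-sum xs p | countB-sum ys p = sum-map-++ (bit ∘ p) xs ys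

countB-map : ∀ {A B : Set} (f : A → B) xs p → countB (map f xs) p ≡ countB xs (p ∘ f)
countB-map f []       p = refl
countB-map f (x ∷ xs) p = cong (_+_ (bit (p (f x)))) (countB-map f xs p)

countB-cong : ∀ {A : Set} {p q : A → Bool} → (∀ x → p x ≡ q x) → ∀ xs → countB xs p ≡ countB xs q
countB-cong p≗q []       = refl
countB-cong p≗q (x ∷ xs) = cong₂ (λ b n → bit b + n) (p≗q x) (countB-cong p≗q xs)

countB-false : ∀ {A : Set} (p : A → Bool) → (∀ x → p x ≡ false) → ∀ xs → countB xs p ≡ 0
countB-false p p≗false xs = trans (countB-sum xs p) (sum-map-zero (bit ∘ p) (cong bit ∘ p≗false) xs)

countB-upTo-last : ∀ (p : ℕ → Bool) n → countB (upTo (suc n)) p ≡ countB (upTo n) p + bit (p n)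
countB-upTo-last p n rewrite countB-sum (upTo (suc n)) p | countB-sum (upTo n) p = sum-upTo-last (bit ∘ p) n

countB-upTo-head : ∀ (p : ℕ → Bool) n → countB (upTo (suc n)) p ≡ bit (p 0) + countB (upTo n) (p ∘ suc)
countB-upTo-head p n = trans (cong (λ xs → countB xs p) (upTo-suc n)) (cong (_+_ (bit (p 0))) (countB-map suc (upTo n) p))

countB-upTo-beyond : ∀ (p : ℕ → Bool) n K → (∀ k → n ≤ k → p k ≡ false) → countB (upTo (n + K)) p ≡ countB (upTo n) p
countB-upTo-beyond p n K p≗false rewrite countB-sum (upTo (n + K)) p | countB-sum (upTo n) p =
  sum-upTo-beyond (bit ∘ p) n K (λ k n≤k → cong bit (p≗false k n≤k))

countB-upTo-mono : ∀ (p : ℕ → Bool) {a b} → a ≤ b → countB (upTo a) p ≤ countB (upTo b) p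
countB-upTo-mono p {a} a≤b with m≤n⇒∃[o]m+o≡n a≤b
... | k , refl = go k
  where
  go : ∀ k → countB (upTo a) p ≤ countB (upTo (a + k)) p
  go zero    rewrite +-identityʳ a = ≤-refl
  go (suc k) rewrite +-suc a k | countB-upTo-last p (a + k) = ≤-trans (go k) (m≤m+n _ _)

allB-map : ∀ f xs p → allB (map f xs) p ≡ allB xs (p ∘ f)
allB-map f []       p = refl
allB-map f (x ∷ xs) p = cong (p (f x) ∧_) (allB-map f xs p)

allB-cong : ∀ {p q : ℕ → Bool} → (∀ x → p x ≡ q x) → ∀ xs → allB xs p ≡ allB xs q
allB-cong p≗q []       = refl
allB-cong p≗q (x ∷ xs) = cong₂ _∧_ (p≗q x) (allB-cong p≗q xs)

allB-upTo-last : ∀ (p : ℕ → Bool) n → allB (upTo (suc n)) p ≡ allB (upTo n) p ∧ p n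
allB-upTo-last p n = trans (cong (λ xs → allB xs p) (sym (upTo-∷ʳ n))) (go (upTo n))
  where
  go : ∀ xs → allB (xs ++ [ n ]) p ≡ allB xs p ∧ p n
  go []       = ∧-identityʳ (p n)
  go (x ∷ xs) rewrite go xs with p x
  ... | true  = refl
  ... | false = refl

allB-upTo-head : ∀ (p : ℕ → Bool) n → allB (upTo (suc n)) p ≡ p 0 ∧ allB (upTo n) (p ∘ suc)
allB-upTo-head p n = trans (cong (λ xs → allB xs p) (upTo-suc n)) (cong (p 0 ∧_) (allB-map suc (upTo n) p))

allB-upTo-cong : ∀ {p q : ℕ → Bool} n → (∀ i → i < n → p i ≡ q i) → allB (upTo n) p ≡ allB (upTo n) q
allB-upTo-cong zero          p≗q = refl
allB-upTo-cong {p} {q} (suc n) p≗q rewrite allB-upTo-last p n | allB-upTo-last q n =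
  cong₂ _∧_ (allB-upTo-cong n (λ i i<n → p≗q i (m<n⇒m<1+n i<n))) (p≗q n (n<1+n n))

allB-upTo-beyond : ∀ (p : ℕ → Bool) n K → (∀ k → n ≤ k → p k ≡ true) → allB (upTo (n + K)) p ≡ allB (upTo n) p
allB-upTo-beyond p n zero    p≗true = cong (λ m → allB (upTo m) p) (+-identityʳ n)
allB-upTo-beyond p n (suc K) p≗true rewrite +-suc n K | allB-upTo-last p (n + K) | p≗true (n + K) (m≤m+n n K) =
  trans (∧-identityʳ _) (allB-upTo-beyond p n K p≗true)

allB-upTo-at : ∀ (p : ℕ → Bool) n → allB (upTo n) p ≡ true → ∀ i → i < n → p i ≡ true
allB-upTo-at p (suc n) all i i<1+n with ∧≡true (trans (sym (allB-upTo-last p n)) all) | m<1+n⇒m<n∨m≡n i<1+n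
... | all-n , _   | inj₁ i<n  = allB-upTo-at p n all-n i i<n
... | _     , p-n | inj₂ refl = p-n

filterB-cong : ∀ {p q : ℕ → Bool} → (∀ x → p x ≡ q x) → ∀ xs → filterB xs p ≡ filterB xs q
filterB-cong p≗q [] = refl
filterB-cong {p} {q} p≗q (x ∷ xs) rewrite p≗q x with q x
... | true  = cong (x ∷_) (filterB-cong p≗q xs)
... | false = filterB-cong p≗q xs

map-filterB-map : ∀ {A : Set} (g : ℕ → A) (f : ℕ → ℕ) xs p →
  map g (filterB (map f xs) p) ≡ map (g ∘ f) (filterB xs (p ∘ f))
map-filterB-map g f []       p = refl
map-filterB-map g f (x ∷ xs) p with p (f x)
... | true  = cong (g (f x) ∷_) (map-filterB-map g f xs p)
... | false = map-filterB-map g f xs p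

filterB-upTo-beyond : ∀ (p : ℕ → Bool) n K → (∀ k → n ≤ k → p k ≡ false) → filterB (upTo (n + K)) p ≡ filterB (upTo n) p
filterB-upTo-beyond p n zero    p≗false = cong (λ m → filterB (upTo m) p) (+-identityʳ n)
filterB-upTo-beyond p n (suc K) p≗false rewrite +-suc n K =
  trans (cong (λ xs → filterB xs p) (sym (upTo-∷ʳ (n + K))))
    (trans (drop-last (upTo (n + K))) (filterB-upTo-beyond p n K p≗false))
  where
  drop-last : ∀ xs → filterB (xs ++ [ n + K ]) p ≡ filterB xs p
  drop-last [] rewrite p≗false (n + K) (m≤m+n n K) = refl
  drop-last (x ∷ xs) with p x
  ... | true  = cong (x ∷_) (drop-last xs)
  ... | false = drop-last xs

HasFalse : List Bool → Set
HasFalse q = Σ ℕ λ i → lookupD q true i ≡ false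

sum-allBits-suc : ∀ (F : List Bool → ℕ) L →
  sum (map F (allBits (suc L))) ≡ sum (map (F ∘ (true ∷_)) (allBits L)) + sum (map (F ∘ (false ∷_)) (allBits L))
sum-allBits-suc F L = trans (sum-map-++ F (map (true ∷_) (allBits L)) (map (false ∷_) (allBits L)))
  (cong₂ (λ xs ys → sum xs + sum ys) (sym (map-∘ (allBits L))) (sym (map-∘ (allBits L))))

sum-allBits-replicate : ∀ K (F : List Bool → ℕ) → (∀ q → HasFalse q → F q ≡ 0) →
  sum (map F (allBits K)) ≡ F (replicate K true)
sum-allBits-replicate zero    F _    = +-identityʳ _
sum-allBits-replicate (suc K) F F≗0 = begin
  sum (map F (allBits (suc K)))                                        ≡⟨ sum-allBits-suc F K ⟩
  sum (map (F ∘ (true ∷_)) (allBits K)) + sum (map (F ∘ (false ∷_)) (allBits K))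
    ≡⟨ cong₂ _+_ (sum-allBits-replicate K (F ∘ (true ∷_)) (λ q (i , qᵢ) → F≗0 (true ∷ q) (suc i , qᵢ)))
                 (sum-map-zero (F ∘ (false ∷_)) (λ q → F≗0 (false ∷ q) (0 , refl)) (allBits K)) ⟩
  F (replicate (suc K) true) + 0                                       ≡⟨ +-identityʳ _ ⟩
  F (replicate (suc K) true)                                           ∎
  where open ≡-Reasoning

sum-allBits-padding : ∀ L K (F : List Bool → ℕ) →
  (∀ p q → length p ≡ L → HasFalse q → F (p ++ q) ≡ 0) →
  (∀ p → length p ≡ L → F (p ++ replicate K true) ≡ F p) →
  sum (map F (allBits (L + K))) ≡ sum (map F (allBits L))
sum-allBits-padding zero    K F F≗0 F-pad =
  trans (sum-allBits-replicate K F (λ q → F≗0 [] q refl)) (trans (F-pad [] refl) (sym (+-identityʳ _)))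
sum-allBits-padding (suc L) K F F≗0 F-pad = begin
  sum (map F (allBits (suc (L + K))))                                              ≡⟨ sum-allBits-suc F (L + K) ⟩
  sum (map (F ∘ (true ∷_)) (allBits (L + K))) + sum (map (F ∘ (false ∷_)) (allBits (L + K)))
    ≡⟨ cong₂ _+_ (onHead true) (onHead false) ⟩
  sum (map (F ∘ (true ∷_)) (allBits L)) + sum (map (F ∘ (false ∷_)) (allBits L))   ≡⟨ sym (sum-allBits-suc F L) ⟩
  sum (map F (allBits (suc L)))                                                    ∎
  where
  open ≡-Reasoning
  onHead : ∀ b → sum (map (F ∘ (b ∷_)) (allBits (L + K))) ≡ sum (map (F ∘ (b ∷_)) (allBits L))
  onHead b = sum-allBits-padding L K (F ∘ (b ∷_))
    (λ p q |p| → F≗0 (b ∷ p) q (cong suc |p|)) (λ p |p| → F-pad (b ∷ p) (cong suc |p|))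

<ᵇ-true : ∀ {a N} → a < N → (a <ᵇ N) ≡ true
<ᵇ-true {zero}  (s≤s _)   = refl
<ᵇ-true {suc a} (s≤s a<N) = <ᵇ-true a<N

<ᵇ-false : ∀ {a N} → N ≤ a → (a <ᵇ N) ≡ false
<ᵇ-false {a} {zero} z≤n  = refl
<ᵇ-false (s≤s N≤a)      = <ᵇ-false N≤a

inD-replicate : ∀ K k → lookupD (replicate K true) true k ≡ true
inD-replicate zero    k       = refl
inD-replicate (suc K) zero    = refl
inD-replicate (suc K) (suc k) = inD-replicate K k

inD-padded : ∀ d K k → inD (d ++ replicate K true) k ≡ inD d k
inD-padded []      K k       = inD-replicate K k
inD-padded (x ∷ d) K zero    = refl
inD-padded (x ∷ d) K (suc k) = inD-padded d K k

inD-≥length : ∀ d k → length d ≤ k → inD d k ≡ true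
inD-≥length []      k       _         = refl
inD-≥length (x ∷ d) (suc k) (s≤s |d|≤k) = inD-≥length d k |d|≤k

inD-++ : ∀ p q i → inD (p ++ q) (length p + i) ≡ lookupD q true i
inD-++ []      q i = refl
inD-++ (x ∷ p) q i = inD-++ p q i

gap<length : ∀ d g → isGap d g ≡ true → g < length d
gap<length d g gap with length d ≤? g
... | yes |d|≤g = ⊥-elim (false≢true (trans (cong not (sym (inD-≥length d g |d|≤g))) gap))
... | no  |d|≰g = ≰⇒> |d|≰g

validB⇒closed : ∀ N M d → validB N M d ≡ true → ∀ k → inD d k ≡ true →
  (inD d (k + N) ≡ true) × (inD d (k + M) ≡ true)
validB⇒closed N M d valid k k∈d with length d ≤? k
... | yes |d|≤k = inD-≥length d (k + N) (≤-trans |d|≤k (m≤m+n k N)) , inD-≥length d (k + M) (≤-trans |d|≤k (m≤m+n k M))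
... | no  |d|≰k = ∧≡true (trans (cong (λ b → not b ∨ (inD d (k + N) ∧ inD d (k + M))) (sym k∈d))
  (allB-upTo-at (λ k → isGap d k ∨ (inD d (k + N) ∧ inD d (k + M))) (length d) valid k (≰⇒> |d|≰k)))

gapsBelow : List Bool → ℕ → ℕ
gapsBelow d B = countB (upTo B) (isGap d)

gapsBelow-gap : ∀ d g → isGap d g ≡ true → gapsBelow d (suc g) ≡ suc (gapsBelow d g)
gapsBelow-gap d g gap rewrite countB-upTo-last (isGap d) g | gap = +-comm (gapsBelow d g) 1

-- g, g − N, …, g − kN are all gaps.
gapsBelow-gap-bound : ∀ N M d → 1 ≤ N → validB N M d ≡ true →
  ∀ k g → k * N ≤ g → isGap d g ≡ true → suc k ≤ gapsBelow d (suc g)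
gapsBelow-gap-bound N M d 1≤N valid zero g _ gap rewrite gapsBelow-gap d g gap = s≤s z≤n
gapsBelow-gap-bound N M d 1≤N valid (suc k) g kN≤g gap rewrite gapsBelow-gap d g gap =
  s≤s (≤-trans (gapsBelow-gap-bound N M d 1≤N valid k (g ∸ N) kN≤g∸N gap-g∸N)
               (countB-upTo-mono (isGap d) g∸N<g))
  where
  N≤g : N ≤ g
  N≤g = ≤-trans (m≤m+n N (k * N)) kN≤g
  kN≤g∸N : k * N ≤ g ∸ N
  kN≤g∸N = m+n≤o⇒m≤o∸n (k * N) (subst (_≤ g) (+-comm N (k * N)) kN≤g)
  g∸N<g : g ∸ N < g
  g∸N<g = ∸-monoʳ-< 1≤N N≤g
  gap-g∸N : isGap d (g ∸ N) ≡ true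
  gap-g∸N with inD d (g ∸ N) in g∸N∈d
  ... | false = refl
  ... | true  = ⊥-elim (false≢true (trans (sym (cong not g∈d)) gap))
    where
    g∈d : inD d g ≡ true
    g∈d = trans (cong (inD d) (sym (m∸n+n≡m N≤g))) (proj₁ (validB⇒closed N M d valid (g ∸ N) g∸N∈d))

gap⇒area-bound : ∀ N M d → 1 ≤ N → validB N M d ≡ true →
  ∀ k g → k * N ≤ g → isGap d g ≡ true → suc k ≤ area d
gap⇒area-bound N M d 1≤N valid k g kN≤g gap =
  ≤-trans (gapsBelow-gap-bound N M d 1≤N valid k g kN≤g gap) (countB-upTo-mono (isGap d) (gap<length d g gap))

codinvTerm : ℕ → ℕ → List Bool → ℕ → ℕ
codinvTerm N M d a = if isNGen N d a then countB (map (λ x → a + x) (upTo M)) (isGap d) else 0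

cogenLambdas : ℕ → ℕ → List Bool → List ℕ
cogenLambdas N M d = map (lamk N M d) (dcogens N M d)

coefOf : List ℕ → ℕ → ℤ → ℕ → ℕ
coefOf ls c i j = countB (expandProd ls) (λ e → eqℤ (+ (c + proj₁ e)) i ∧ (proj₂ e ≡ᵇ j))

termCoef≡coefOf : ∀ N M d i j → termCoef N M d i j ≡ coefOf (cogenLambdas N M d) (codinv N M d) i j
termCoef≡coefOf N M d i j = countB-cong (λ { (x , y) → refl }) (expandProd (cogenLambdas N M d))

module Padding (N M : ℕ) (d : List Bool) (K : ℕ) where

  padded : List Bool
  padded = d ++ replicate K true

  length-padded : length padded ≡ length d + K
  length-padded = trans (length-++ d) (cong (_+_ (length d)) (length-replicate K))

  isGap-padded : ∀ k → isGap padded k ≡ isGap d k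
  isGap-padded k = cong not (inD-padded d K k)

  validB-padded : validB N M padded ≡ validB N M d
  validB-padded = begin
    allB (upTo (length padded)) (closedAt padded)  ≡⟨ cong (λ L → allB (upTo L) (closedAt padded)) length-padded ⟩
    allB (upTo (length d + K)) (closedAt padded)   ≡⟨ allB-cong closedAt-padded (upTo (length d + K)) ⟩
    allB (upTo (length d + K)) (closedAt d)        ≡⟨ allB-upTo-beyond (closedAt d) (length d) K closedAt-beyond ⟩
    allB (upTo (length d)) (closedAt d)            ∎
    where
    open ≡-Reasoning
    closedAt : List Bool → ℕ → Bool
    closedAt e k = isGap e k ∨ (inD e (k + N) ∧ inD e (k + M))
    closedAt-padded : ∀ k → closedAt padded k ≡ closedAt d k
    closedAt-padded k = cong₂ (λ a bc → not a ∨ bc) (inD-padded d K k)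
      (cong₂ _∧_ (inD-padded d K (k + N)) (inD-padded d K (k + M)))
    closedAt-beyond : ∀ k → length d ≤ k → closedAt d k ≡ true
    closedAt-beyond k |d|≤k rewrite inD-≥length d k |d|≤k
      | inD-≥length d (k + N) (≤-trans |d|≤k (m≤m+n k N)) | inD-≥length d (k + M) (≤-trans |d|≤k (m≤m+n k M)) = refl

  matchesB-padded : ∀ u → matchesB N M u padded ≡ matchesB N M u d
  matchesB-padded u = allB-cong (λ i → cong (λ a → eqB a (lookupD u false i)) (inD-padded d K i)) (upTo (N + M))

  area-padded : area padded ≡ area d
  area-padded = trans (cong (λ L → gapsBelow padded L) length-padded)
    (trans (countB-cong isGap-padded (upTo (length d + K)))
      (countB-upTo-beyond (isGap d) (length d) K (λ k |d|≤k → cong not (inD-≥length d k |d|≤k))))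

  isNGen-padded : ∀ a → isNGen N padded a ≡ isNGen N d a
  isNGen-padded a = cong₂ (λ x y → x ∧ (if a <ᵇ N then true else not y)) (inD-padded d K a) (inD-padded d K (a ∸ N))

  isNGen-beyond : ∀ a → length d + N ≤ a → isNGen N d a ≡ false
  isNGen-beyond a |d|+N≤a rewrite <ᵇ-false (≤-trans (m≤n+m N (length d)) |d|+N≤a)
    | inD-≥length d (a ∸ N) (m+n≤o⇒m≤o∸n (length d) |d|+N≤a) = ∧-zeroʳ (inD d a)

  codinv-padded : codinv N M padded ≡ codinv N M d
  codinv-padded = begin
    sum (map (codinvTerm N M padded) (upTo (length padded + N)))  ≡⟨ cong (λ L → sum (map (codinvTerm N M padded) (upTo L))) range ⟩
    sum (map (codinvTerm N M padded) (upTo (length d + N + K)))   ≡⟨ sum-map-cong term-padded (upTo (length d + N + K)) ⟩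
    sum (map (codinvTerm N M d) (upTo (length d + N + K)))        ≡⟨ sum-upTo-beyond (codinvTerm N M d) (length d + N) K term-beyond ⟩
    sum (map (codinvTerm N M d) (upTo (length d + N)))            ∎
    where
    open ≡-Reasoning
    range : length padded + N ≡ length d + N + K
    range rewrite length-padded | +-assoc (length d) K N | +-comm K N = sym (+-assoc (length d) N K)
    term-padded : ∀ a → codinvTerm N M padded a ≡ codinvTerm N M d a
    term-padded a = cong₂ (λ b c → if b then c else 0) (isNGen-padded a) (countB-cong isGap-padded (map (λ x → a + x) (upTo M)))
    term-beyond : ∀ a → length d + N ≤ a → codinvTerm N M d a ≡ 0
    term-beyond a |d|+N≤a rewrite isNGen-beyond a |d|+N≤a = refl

  cogenLambdas-padded : cogenLambdas N M padded ≡ cogenLambdas N M d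
  cogenLambdas-padded = trans (map-cong (λ k → countB-cong isNGen-padded (map (λ x → k + N + 1 + x) (upTo M))) (dcogens N M padded))
    (cong (map (lamk N M d)) dcogens-padded)
    where
    cogenAt : List Bool → ℕ → Bool
    cogenAt e k = isGap e k ∧ (inD e (k + N) ∧ inD e (k + M))
    dcogens-padded : dcogens N M padded ≡ dcogens N M d
    dcogens-padded = trans (cong (λ L → filterB (upTo L) (cogenAt padded)) length-padded)
      (trans (filterB-cong (λ k → cong₂ (λ a bc → not a ∧ bc) (inD-padded d K k)
                 (cong₂ _∧_ (inD-padded d K (k + N)) (inD-padded d K (k + M)))) (upTo (length d + K)))
        (filterB-upTo-beyond (cogenAt d) (length d) K
          (λ k |d|≤k → cong (λ a → not a ∧ (inD d (k + N) ∧ inD d (k + M))) (inD-≥length d k |d|≤k))))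

  termCoef-padded : ∀ i j → termCoef N M padded i j ≡ termCoef N M d i j
  termCoef-padded i j = trans (termCoef≡coefOf N M padded i j)
    (trans (cong₂ (λ ls c → coefOf ls c i j) cogenLambdas-padded codinv-padded) (sym (termCoef≡coefOf N M d i j)))

onlyIf : Bool → ℕ → ℕ
onlyIf b X = if b then X else 0

onlyIf-cong : ∀ {b b′ X Y} → b ≡ b′ → (b′ ≡ true → X ≡ Y) → onlyIf b X ≡ onlyIf b′ Y
onlyIf-cong {b′ = true}  refl X≡Y = X≡Y refl
onlyIf-cong {b′ = false} refl _   = refl

onlyIf-zero : ∀ b → onlyIf b 0 ≡ 0
onlyIf-zero true  = refl
onlyIf-zero false = refl

onlyIf-+ : ∀ b X Y → onlyIf b (X + Y) ≡ onlyIf b X + onlyIf b Y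
onlyIf-+ true  X Y = refl
onlyIf-+ false X Y = refl

counted : ℕ → ℕ → List Bool → ℕ → List Bool → Bool
counted N M u n d = validB N M d ∧ (matchesB N M u d ∧ (area d ≡ᵇ n))

PhatSummand : ℕ → ℕ → List Bool → ℕ → ℤ → ℕ → List Bool → ℕ
PhatSummand N M u n i j d = onlyIf (counted N M u n d) (termCoef N M d i j)

counted⇒validB : ∀ {N M u n} d → counted N M u n d ≡ true → validB N M d ≡ true
counted⇒validB d c = proj₁ (∧≡true c)

counted⇒matchesB : ∀ {N M u n} d → counted N M u n d ≡ true → matchesB N M u d ≡ true
counted⇒matchesB {N} {M} d c = proj₁ (∧≡true (proj₂ (∧≡true {validB N M d} c)))

counted⇒area : ∀ {N M u n} d → counted N M u n d ≡ true → area d ≡ n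
counted⇒area {N} {M} {u} {n} d c =
  ≡ᵇ⇒≡ (area d) n (subst T (sym (proj₂ (∧≡true {matchesB N M u d} (proj₂ (∧≡true {validB N M d} c))))) tt)

PhatSummand-padded : ∀ N M u n i j d K → PhatSummand N M u n i j (d ++ replicate K true) ≡ PhatSummand N M u n i j d
PhatSummand-padded N M u n i j d K = onlyIf-cong
  (cong₂ _∧_ validB-padded (cong₂ (λ m a → m ∧ (a ≡ᵇ n)) (matchesB-padded u) area-padded))
  (λ _ → termCoef-padded i j)
  where open Padding N M d K

PhatSummand-gap : ∀ N M u n i j → 1 ≤ N → ∀ p q → n * N ≤ length p → HasFalse q → PhatSummand N M u n i j (p ++ q) ≡ 0
PhatSummand-gap N M u n i j 1≤N p q nN≤|p| (k , qₖ) with counted N M u n (p ++ q) in c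
... | false = refl
... | true  = ⊥-elim (<-irrefl refl (subst (n <_) (counted⇒area {N} {M} {u} (p ++ q) c)
  (gap⇒area-bound N M (p ++ q) 1≤N (counted⇒validB {N} {M} {u} (p ++ q) c) n (length p + k)
    (≤-trans nN≤|p| (m≤m+n (length p) k)) (cong not (trans (inD-++ p q k) qₖ)))))

Phat-allBits : ∀ N M u n i j → 1 ≤ N → ∀ L → n * N ≤ L →
  Phat N M u n i j ≡ sum (map (PhatSummand N M u n i j) (allBits L))
Phat-allBits N M u n i j 1≤N L nN≤L with m≤n⇒∃[o]m+o≡n nN≤L
... | K , refl = sym (sum-allBits-padding (n * N) K (PhatSummand N M u n i j)
  (λ p q |p| → PhatSummand-gap N M u n i j 1≤N p q (≤-reflexive (sym |p|)))
  (λ p _ → PhatSummand-padded N M u n i j p K))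

∸-suc : ∀ a N′ → suc N′ ≤ a → a ∸ N′ ≡ suc (a ∸ suc N′)
∸-suc (suc a) zero     _           = refl
∸-suc (suc a) (suc N′) (s≤s N′<a) = ∸-suc a N′ N′<a

-- Dropping the first entry of d represents {k ∣ k + 1 ∈ Δ}.
module Tail (N′ M′ : ℕ) where
  N M : ℕ
  N = suc N′
  M = suc M′

  validB-∷false : ∀ r → validB N M (false ∷ r) ≡ validB N M r
  validB-∷false r = allB-upTo-head (λ k → isGap (false ∷ r) k ∨ (inD (false ∷ r) (k + N) ∧ inD (false ∷ r) (k + M))) (length r)

  validB-∷true : ∀ r → validB N M (true ∷ r) ≡ (inD r N′ ∧ inD r M′) ∧ validB N M r
  validB-∷true r = allB-upTo-head (λ k → isGap (true ∷ r) k ∨ (inD (true ∷ r) (k + N) ∧ inD (true ∷ r) (k + M))) (length r)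

  area-∷false : ∀ r → area (false ∷ r) ≡ suc (area r)
  area-∷false r = countB-upTo-head (isGap (false ∷ r)) (length r)

  area-∷true : ∀ r → area (true ∷ r) ≡ area r
  area-∷true r = countB-upTo-head (isGap (true ∷ r)) (length r)

  matchesB-∷ : ∀ x u b r → matchesB N M (x ∷ u) (b ∷ r) ≡ eqB b x ∧ allB (upTo (N′ + M)) (λ i → eqB (inD r i) (lookupD u false i))
  matchesB-∷ x u b r = allB-upTo-head (λ i → eqB (inD (b ∷ r) i) (lookupD (x ∷ u) false i)) (N′ + M)

  PhatSummand-∷-mismatch : ∀ x u n i j r → PhatSummand N M (x ∷ u) n i j (not x ∷ r) ≡ 0
  PhatSummand-∷-mismatch true  u n i j r = cong (λ b → onlyIf b (termCoef N M (false ∷ r) i j)) (∧-zeroʳ (validB N M (false ∷ r)))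
  PhatSummand-∷-mismatch false u n i j r = cong (λ b → onlyIf b (termCoef N M (true ∷ r) i j)) (∧-zeroʳ (validB N M (true ∷ r)))

  isNGen-∷ : ∀ b r a → a ≢ N′ → isNGen N (b ∷ r) (suc a) ≡ isNGen N r a
  isNGen-∷ b r a a≢N′ with <-cmp a N′
  ... | tri< a<N′ _ _ rewrite <ᵇ-true a<N′ | <ᵇ-true (m<n⇒m<1+n a<N′) = refl
  ... | tri≈ _ a≡N′ _ = ⊥-elim (a≢N′ a≡N′)
  ... | tri> _ _ N′<a rewrite <ᵇ-false (<⇒≤ N′<a) | <ᵇ-false N′<a | ∸-suc a N′ N′<a = refl

  isNGen-∷false-N : ∀ r → isNGen N (false ∷ r) N ≡ isNGen N r N′
  isNGen-∷false-N r rewrite <ᵇ-false (≤-refl {N}) | n∸n≡0 N | <ᵇ-true (n<1+n N′) = refl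

  isNGen-∷true-N : ∀ r → isNGen N (true ∷ r) N ≡ false
  isNGen-∷true-N r rewrite <ᵇ-false (≤-refl {N}) | n∸n≡0 N = ∧-zeroʳ (inD r N′)

  isNGen-∷false : ∀ r a → isNGen N (false ∷ r) (suc a) ≡ isNGen N r a
  isNGen-∷false r a with a ≟ N′
  ... | yes refl = isNGen-∷false-N r
  ... | no a≢N′  = isNGen-∷ false r a a≢N′

  window-∷ : ∀ b r a → countB (map (λ x → suc a + x) (upTo M)) (isGap (b ∷ r)) ≡ countB (map (λ x → a + x) (upTo M)) (isGap r)
  window-∷ b r a = trans (countB-map (λ x → suc a + x) (upTo M) (isGap (b ∷ r))) (sym (countB-map (λ x → a + x) (upTo M) (isGap r)))

  codinvTerm-∷ : ∀ b r a → a ≢ N′ → codinvTerm N M (b ∷ r) (suc a) ≡ codinvTerm N M r a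
  codinvTerm-∷ b r a a≢N′ = cong₂ (λ g c → if g then c else 0) (isNGen-∷ b r a a≢N′) (window-∷ b r a)

  codinv-∷false : ∀ r → codinv N M (false ∷ r) ≡ codinv N M r
  codinv-∷false r = trans (sum-upTo-head (codinvTerm N M (false ∷ r)) (length r + N))
    (sum-map-cong (λ a → cong₂ (λ g c → if g then c else 0) (isNGen-∷false r a) (window-∷ false r a)) (upTo (length r + N)))

  codinv-∷true : ∀ r → inD r N′ ≡ true →
    codinv N M (true ∷ r) + countB (upTo M) (λ x → isGap (true ∷ r) (N + x)) ≡ countB (upTo M) (isGap (true ∷ r)) + codinv N M r
  codinv-∷true r N′∈r = begin
    codinv N M (true ∷ r) + A                       ≡⟨ cong (_+ A) (sum-upTo-head (codinvTerm N M (true ∷ r)) (length r + N)) ⟩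
    codinvTerm N M (true ∷ r) 0 + S + A             ≡⟨ +-assoc (codinvTerm N M (true ∷ r) 0) S A ⟩
    codinvTerm N M (true ∷ r) 0 + (S + A)           ≡⟨ cong₂ _+_ term0 (cong (_+_ S) (sym termN′)) ⟩
    G₀ + (S + codinvTerm N M r N′)                  ≡⟨ cong (_+_ G₀) others ⟩
    G₀ + codinv N M r                               ∎
    where
    open ≡-Reasoning
    A  = countB (upTo M) (λ x → isGap (true ∷ r) (N + x))
    G₀ = countB (upTo M) (isGap (true ∷ r))
    S  = sum (map (codinvTerm N M (true ∷ r) ∘ suc) (upTo (length r + N)))
    term0 : codinvTerm N M (true ∷ r) 0 ≡ G₀
    term0 = countB-map (λ x → 0 + x) (upTo M) (isGap (true ∷ r))
    termN′ : codinvTerm N M r N′ ≡ A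
    termN′ rewrite <ᵇ-true (n<1+n N′) | ∧-identityʳ (inD r N′) | N′∈r = countB-map (λ x → N′ + x) (upTo M) (isGap r)
    others : S + codinvTerm N M r N′ ≡ codinv N M r
    others = sum-upTo-except (length r + N) N′ (codinvTerm N M (true ∷ r) ∘ suc) (codinvTerm N M r)
      (≤-trans (n<1+n N′) (m≤n+m N (length r))) (codinvTerm-∷ true r)
      (cong (λ g → if g then countB (map (λ x → N + x) (upTo M)) (isGap (true ∷ r)) else 0) (isNGen-∷true-N r))

  lamk-∷ : ∀ b r k → lamk N M (b ∷ r) (suc k) ≡ lamk N M r k
  lamk-∷ b r k = trans (countB-map (λ x → suc k + N + 1 + x) (upTo M) (isNGen N (b ∷ r)))
    (trans (countB-cong (λ x → isNGen-∷ b r (k + N + 1 + x) (λ e → <-irrefl (sym e) (N′<window x))) (upTo M))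
      (sym (countB-map (λ x → k + N + 1 + x) (upTo M) (isNGen N r))))
    where
    N′<window : ∀ x → N′ < k + N + 1 + x
    N′<window x = ≤-trans (m≤n+m N k) (≤-trans (m≤m+n (k + N) 1) (m≤m+n (k + N + 1) x))

  lamk-∷false-0 : ∀ r → lamk N M (false ∷ r) 0 ≡ countB (upTo M) (λ x → isNGen N r (N + x))
  lamk-∷false-0 r = trans (countB-map (λ x → 0 + N + 1 + x) (upTo M) (isNGen N (false ∷ r)))
    (countB-cong (λ x → trans (isNGen-∷false r (N′ + 1 + x)) (cong (λ y → isNGen N r (y + x)) (+-comm N′ 1))) (upTo M))

  cogenLambdas-∷ : ∀ b r → cogenLambdas N M (b ∷ r)
    ≡ (if not b ∧ (inD r N′ ∧ inD r M′) then lamk N M (b ∷ r) 0 ∷ cogenLambdas N M r else cogenLambdas N M r)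
  cogenLambdas-∷ b r = trans (cong (λ ks → map (lamk N M (b ∷ r)) (filterB ks cogenAt)) (upTo-suc (length r))) split
    where
    cogenAt = λ k → isGap (b ∷ r) k ∧ (inD (b ∷ r) (k + N) ∧ inD (b ∷ r) (k + M))
    rest : map (lamk N M (b ∷ r)) (filterB (map suc (upTo (length r))) cogenAt) ≡ cogenLambdas N M r
    rest = trans (map-filterB-map (lamk N M (b ∷ r)) suc (upTo (length r)) cogenAt) (map-cong (lamk-∷ b r) _)
    split : map (lamk N M (b ∷ r)) (filterB (0 ∷ map suc (upTo (length r))) cogenAt)
      ≡ (if not b ∧ (inD r N′ ∧ inD r M′) then lamk N M (b ∷ r) 0 ∷ cogenLambdas N M r else cogenLambdas N M r)
    split with not b ∧ (inD r N′ ∧ inD r M′)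
    ... | true  = cong (lamk N M (b ∷ r) 0 ∷_) rest
    ... | false = rest

eqℤ-shift : ∀ a b c → eqℤ a b ≡ eqℤ (a - c) (b - c)
eqℤ-shift a b c with a ℤ.≟ b | (a - c) ℤ.≟ (b - c)
... | yes _   | yes _   = refl
... | no  _   | no  _   = refl
... | yes a≡b | no  a≢b = ⊥-elim (a≢b (cong (_- c) a≡b))
... | no  a≢b | yes a≡b = ⊥-elim (a≢b (trans (sym (-+ a c)) (trans (cong (ℤ._+ c) a≡b) (-+ b c))))
  where
  -+ : ∀ x y → (x - y) ℤ.+ y ≡ x
  -+ = solve-∀

aShift : (ℤ → ℕ → ℕ) → ℤ → ℕ → ℕ
aShift F i zero    = 0
aShift F i (suc j) = F i j

coefOf-∷ : ∀ l ls c i j → coefOf (l ∷ ls) c i j ≡ coefOf ls c i j + aShift (coefOf ls c) (i - + l) j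
coefOf-∷ l ls c i j = trans (countB-++ (expandProd ls) _ _)
  (cong (_+_ (coefOf ls c i j)) (trans (countB-map _ (expandProd ls) _) (withA j)))
  where
  withA : ∀ j → countB (expandProd ls) (λ e → eqℤ (+ (c + (proj₁ e + l))) i ∧ (suc (proj₂ e) ≡ᵇ j))
    ≡ aShift (coefOf ls c) (i - + l) j
  withA zero    = countB-false _ (λ _ → ∧-zeroʳ _) (expandProd ls)
  withA (suc j) = countB-cong (λ { (x , y) → cong (_∧ (y ≡ᵇ j))
    (trans (eqℤ-shift (+ (c + (x + l))) i (+ l)) (cong (λ z → eqℤ z (i - + l)) (shift x))) }) (expandProd ls)
    where
    shift : ∀ x → + (c + (x + l)) - + l ≡ + (c + x)
    shift x rewrite ℤ.pos-+ c (x + l) | ℤ.pos-+ x l | ℤ.pos-+ c x = cancel (+ c) (+ x) (+ l)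
      where
      cancel : ∀ a b d → a ℤ.+ (b ℤ.+ d) - d ≡ a ℤ.+ b
      cancel = solve-∀

coefOf-offset : ∀ ls c c′ δ → + c ≡ + c′ ℤ.+ δ → ∀ i j → coefOf ls c i j ≡ coefOf ls c′ (i - δ) j
coefOf-offset ls c c′ δ c≡c′+δ i j = countB-cong (λ { (x , y) → cong (_∧ (y ≡ᵇ j))
  (trans (eqℤ-shift (+ (c + x)) i δ) (cong (λ z → eqℤ z (i - δ)) (offset x))) }) (expandProd ls)
  where
  offset : ∀ x → + (c + x) - δ ≡ + (c′ + x)
  offset x = begin
    + (c + x) - δ                   ≡⟨ cong (_- δ) (ℤ.pos-+ c x) ⟩
    (+ c ℤ.+ + x) - δ               ≡⟨ cong (λ z → (z ℤ.+ + x) - δ) c≡c′+δ ⟩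
    ((+ c′ ℤ.+ δ) ℤ.+ + x) - δ      ≡⟨ cancel (+ c′) (+ x) δ ⟩
    + c′ ℤ.+ + x                    ≡⟨ sym (ℤ.pos-+ c′ x) ⟩
    + (c′ + x)                      ∎
    where
    open ≡-Reasoning
    cancel : ∀ a b d → (a ℤ.+ d) ℤ.+ b - d ≡ a ℤ.+ b
    cancel = solve-∀

sumℤ-upTo-last : ∀ (h : ℕ → ℤ) n → sumℤ (map h (upTo (suc n))) ≡ sumℤ (map h (upTo n)) ℤ.+ h n
sumℤ-upTo-last h n = trans (cong (sumℤ ∘ map h) (sym (upTo-∷ʳ n))) (go (upTo n))
  where
  go : ∀ xs → sumℤ (map h (xs ++ [ n ])) ≡ sumℤ (map h xs) ℤ.+ h n
  go []       = trans (ℤ.+-identityʳ (h n)) (sym (ℤ.+-identityˡ (h n)))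
  go (x ∷ xs) = trans (cong (ℤ._+_ (h x)) (go xs)) (sym (ℤ.+-assoc (h x) _ (h n)))

sumℤ-bits : ∀ (h : ℕ → ℤ) (p q : ℕ → Bool) K → (∀ x → x < K → h x ≡ + bit (p x) - + bit (q x)) →
  sumℤ (map h (upTo K)) ≡ + countB (upTo K) p - + countB (upTo K) q
sumℤ-bits h p q zero    _ = refl
sumℤ-bits h p q (suc K) h≗ = begin
  sumℤ (map h (upTo (suc K)))                                             ≡⟨ sumℤ-upTo-last h K ⟩
  sumℤ (map h (upTo K)) ℤ.+ h K
    ≡⟨ cong₂ ℤ._+_ (sumℤ-bits h p q K (λ x x<K → h≗ x (m<n⇒m<1+n x<K))) (h≗ K (n<1+n K)) ⟩
  (+ countB (upTo K) p - + countB (upTo K) q) ℤ.+ (+ bit (p K) - + bit (q K))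
    ≡⟨ regroup (+ countB (upTo K) p) (+ countB (upTo K) q) (+ bit (p K)) (+ bit (q K)) ⟩
  (+ countB (upTo K) p ℤ.+ + bit (p K)) - (+ countB (upTo K) q ℤ.+ + bit (q K)) ≡⟨ cong₂ _-_ (last p) (last q) ⟩
  + countB (upTo (suc K)) p - + countB (upTo (suc K)) q                   ∎
  where
  open ≡-Reasoning
  regroup : ∀ a b c d → (a - b) ℤ.+ (c - d) ≡ (a ℤ.+ c) - (b ℤ.+ d)
  regroup = solve-∀
  last : ∀ g → + countB (upTo K) g ℤ.+ + bit (g K) ≡ + countB (upTo (suc K)) g
  last g = trans (sym (ℤ.pos-+ (countB (upTo K) g) (bit (g K)))) (cong +_ (sym (countB-upTo-last g K)))

bit-flip : ∀ a b → + bit a - + bit b ≡ + bit (not b) - + bit (not a)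
bit-flip true  true  = refl
bit-flip true  false = refl
bit-flip false true  = refl
bit-flip false false = refl

bit-implication : ∀ a b → (a ≡ true → b ≡ true) → + bit b - + bit a ≡ + bit (b ∧ not a) - + bit false
bit-implication true  true  _   = refl
bit-implication true  false a⇒b with a⇒b refl
... | ()
bit-implication false true  _   = refl
bit-implication false false _   = refl

onlyIf-split : ∀ V W A t X →
  onlyIf (V ∧ (W ∧ A)) X ≡ onlyIf (V ∧ ((W ∧ eqB t true) ∧ A)) X + onlyIf (V ∧ ((W ∧ eqB t false) ∧ A)) X
onlyIf-split true  true  true  true  X = sym (+-identityʳ X)
onlyIf-split true  true  true  false X = refl
onlyIf-split true  true  false true  X = refl
onlyIf-split true  true  false false X = refl
onlyIf-split true  false A     t     X = refl
onlyIf-split false W     A     t     X = refl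

∧-eqB-forced : ∀ V W A t → (V ≡ true → W ≡ true → t ≡ true) → V ∧ (W ∧ A) ≡ V ∧ ((W ∧ eqB t true) ∧ A)
∧-eqB-forced true  true  A true  _     = refl
∧-eqB-forced true  true  A false V⇒W⇒t with V⇒W⇒t refl refl
... | ()
∧-eqB-forced true  false A t     _     = refl
∧-eqB-forced false W     A t     _     = refl

∧-redundant : ∀ c V W A → (W ≡ true → c ≡ true) → (c ∧ V) ∧ (W ∧ A) ≡ V ∧ (W ∧ A)
∧-redundant c V false A _   = trans (∧-zeroʳ (c ∧ V)) (sym (∧-zeroʳ V))
∧-redundant c V true  A W⇒c rewrite W⇒c refl = refl

lookupD-∷ʳ-< : ∀ (u : List Bool) c i → i < length u → lookupD (u ++ c ∷ []) false i ≡ lookupD u false i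
lookupD-∷ʳ-< (y ∷ u) c zero    _         = refl
lookupD-∷ʳ-< (y ∷ u) c (suc i) (s≤s i<u) = lookupD-∷ʳ-< u c i i<u

lookupD-∷ʳ-length : ∀ (u : List Bool) c → lookupD (u ++ c ∷ []) false (length u) ≡ c
lookupD-∷ʳ-length []      c = refl
lookupD-∷ʳ-length (y ∷ u) c = lookupD-∷ʳ-length u c

-- P = N + M − 1 is the one entry of the tail not prescribed by u = x ∷ u′; it separates v from v′.
module FirstEntry (N′ M′ : ℕ) (u′ : List Bool) (|u′| : length u′ ≡ N′ + suc M′) where
  open Tail N′ M′

  P : ℕ
  P = N′ + M

  v : Bool → List Bool
  v c = u′ ++ c ∷ []

  matchesTail : List Bool → Bool
  matchesTail r = allB (upTo P) (λ i → eqB (inD r i) (lookupD u′ false i))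

  matchesTail-at : ∀ r → matchesTail r ≡ true → ∀ i → i < P → inD r i ≡ lookupD u′ false i
  matchesTail-at r m i i<P = eqB≡true (allB-upTo-at (λ i → eqB (inD r i) (lookupD u′ false i)) P m i i<P)

  matchesB-v : ∀ c r → matchesB N M (v c) r ≡ matchesTail r ∧ eqB (inD r P) c
  matchesB-v c r = trans (allB-upTo-last (λ i → eqB (inD r i) (lookupD (v c) false i)) P)
    (cong₂ _∧_ (allB-upTo-cong P (λ i i<P → cong (eqB (inD r i)) (lookupD-∷ʳ-< u′ c i (subst (i <_) (sym |u′|) i<P))))
      (cong (eqB (inD r P)) (trans (cong (lookupD (v c) false) (sym |u′|)) (lookupD-∷ʳ-length u′ c))))

  N′<P : N′ < P
  N′<P = m<m+n N′ (s≤s z≤n)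

  M′<P : M′ < P
  M′<P = ≤-trans (n<1+n M′) (m≤n+m M N′)

  at-N′ : ∀ r → matchesTail r ≡ true → inD r N′ ≡ lookupD u′ false N′
  at-N′ r m = matchesTail-at r m N′ N′<P

  at-M′ : ∀ r → matchesTail r ≡ true → inD r M′ ≡ lookupD u′ false M′
  at-M′ r m = matchesTail-at r m M′ M′<P

  P∈tail : ∀ r → validB N M r ≡ true → matchesTail r ≡ true →
    lookupD u′ false N′ ≡ true ⊎ lookupD u′ false M′ ≡ true → inD r P ≡ true
  P∈tail r valid m (inj₁ uN) = proj₂ (validB⇒closed N M r valid N′ (trans (at-N′ r m) uN))
  P∈tail r valid m (inj₂ uM) = trans (cong (inD r) P≡M′+N) (proj₁ (validB⇒closed N M r valid M′ (trans (at-M′ r m) uM)))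
    where
    P≡M′+N : P ≡ M′ + N
    P≡M′+N rewrite +-suc N′ M′ | +-suc M′ N′ = cong suc (+-comm N′ M′)

  counted-∷false : ∀ m r → counted N M (false ∷ u′) (suc m) (false ∷ r) ≡ validB N M r ∧ (matchesTail r ∧ (area r ≡ᵇ m))
  counted-∷false m r = cong₂ _∧_ (validB-∷false r) (cong₂ _∧_ (matchesB-∷ false u′ false r) (cong (_≡ᵇ suc m) (area-∷false r)))

  counted-v : ∀ c m r → counted N M (v c) m r ≡ validB N M r ∧ ((matchesTail r ∧ eqB (inD r P) c) ∧ (area r ≡ᵇ m))
  counted-v c m r = cong (λ z → validB N M r ∧ (z ∧ (area r ≡ᵇ m))) (matchesB-v c r)

  counted-v⇒matchesTail : ∀ c m r → counted N M (v c) m r ≡ true → matchesTail r ≡ true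
  counted-v⇒matchesTail c m r cnt = proj₁ (∧≡true (trans (sym (matchesB-v c r)) (counted⇒matchesB {N} {M} {v c} {m} r cnt)))

  cogenLambdas-∷false : Bool → List Bool → List ℕ
  cogenLambdas-∷false cogen₀ r = if cogen₀ then lamk N M (false ∷ r) 0 ∷ cogenLambdas N M r else cogenLambdas N M r

  termCoef-∷false : ∀ r i j → termCoef N M (false ∷ r) i j
    ≡ coefOf (cogenLambdas-∷false (inD r N′ ∧ inD r M′) r) (codinv N M r) i j
  termCoef-∷false r i j = trans (termCoef≡coefOf N M (false ∷ r) i j)
    (cong₂ (λ ls c → coefOf ls c i j) (cogenLambdas-∷ false r) (codinv-∷false r))

  summand-∷false : ∀ m i j r → (matchesTail r ≡ true → (inD r N′ ∧ inD r M′) ≡ false) →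
    PhatSummand N M (false ∷ u′) (suc m) i j (false ∷ r) ≡ onlyIf (validB N M r ∧ (matchesTail r ∧ (area r ≡ᵇ m))) (termCoef N M r i j)
  summand-∷false m i j r no-cogen = onlyIf-cong (counted-∷false m r) λ cnt →
    trans (termCoef-∷false r i j)
      (trans (cong (λ b → coefOf (cogenLambdas-∷false b r) (codinv N M r) i j)
                   (no-cogen (proj₁ (∧≡true (proj₂ (∧≡true {validB N M r} cnt))))))
             (sym (termCoef≡coefOf N M r i j)))

  summand-v : ∀ c m i j r → PhatSummand N M (v c) m i j r
    ≡ onlyIf (validB N M r ∧ ((matchesTail r ∧ eqB (inD r P) c) ∧ (area r ≡ᵇ m))) (termCoef N M r i j)
  summand-v c m i j r = onlyIf-cong (counted-v c m r) (λ _ → refl)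

  summand-case₁ : lookupD u′ false N′ ≡ false → ∀ m i j r →
    PhatSummand N M (false ∷ u′) (suc m) i j (false ∷ r) ≡ PhatSummand N M (v true) m i j r + PhatSummand N M (v false) m i j r
  summand-case₁ uN m i j r = begin
    PhatSummand N M (false ∷ u′) (suc m) i j (false ∷ r)
      ≡⟨ summand-∷false m i j r (λ mt → cong (_∧ inD r M′) (trans (at-N′ r mt) uN)) ⟩
    onlyIf (validB N M r ∧ (matchesTail r ∧ (area r ≡ᵇ m))) (termCoef N M r i j)
      ≡⟨ onlyIf-split (validB N M r) (matchesTail r) (area r ≡ᵇ m) (inD r P) (termCoef N M r i j) ⟩
    _ ≡⟨ sym (cong₂ _+_ (summand-v true m i j r) (summand-v false m i j r)) ⟩
    PhatSummand N M (v true) m i j r + PhatSummand N M (v false) m i j r ∎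
    where open ≡-Reasoning

  summand-case₂ : ExactlyOne (lookupD u′ false N′) (lookupD u′ false M′) →
    ∀ m i j r → PhatSummand N M (false ∷ u′) (suc m) i j (false ∷ r) ≡ PhatSummand N M (v true) m i j r
  summand-case₂ uNM m i j r = trans (summand-∷false m i j r (no-cogen uNM))
    (trans (cong (λ b → onlyIf b (termCoef N M r i j))
                 (∧-eqB-forced (validB N M r) (matchesTail r) (area r ≡ᵇ m) (inD r P) (λ valid mt → P∈tail r valid mt one-of)))
           (sym (summand-v true m i j r)))
    where
    one-of : lookupD u′ false N′ ≡ true ⊎ lookupD u′ false M′ ≡ true
    one-of = Sum.map proj₁ proj₂ uNM
    no-cogen : ExactlyOne (lookupD u′ false N′) (lookupD u′ false M′) →
      matchesTail r ≡ true → (inD r N′ ∧ inD r M′) ≡ false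
    no-cogen (inj₁ (uN , uM)) mt rewrite at-N′ r mt | at-M′ r mt | uN | uM = refl
    no-cogen (inj₂ (uN , uM)) mt rewrite at-N′ r mt | at-M′ r mt | uN | uM = refl

  -- For Δ valid, k ∈ Δ ⇒ k + N ∈ Δ, so u_{k+N} − u_k counts the N-generators k + N.
  lambda-v-cogen : ∀ m r → counted N M (v true) m r ≡ true → + lamk N M (false ∷ r) 0 ≡ lambdaSeq N M (v true)
  lambda-v-cogen m r cnt = sym (begin
    lambdaSeq N M (v true)                                      ≡⟨ sumℤ-bits _ gen (λ _ → false) M pointwise ⟩
    + countB (upTo M) gen - + countB (upTo M) (λ _ → false)
      ≡⟨ cong (λ z → + countB (upTo M) gen - + z) (countB-false (λ _ → false) (λ _ → refl) (upTo M)) ⟩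
    + countB (upTo M) gen ℤ.+ ℤ.- + 0                           ≡⟨ ℤ.+-identityʳ _ ⟩
    + countB (upTo M) gen                                       ≡⟨ cong +_ (sym (lamk-∷false-0 r)) ⟩
    + lamk N M (false ∷ r) 0                                    ∎)
    where
    open ≡-Reasoning
    valid = counted⇒validB {N} {M} {v true} {m} r cnt
    gen : ℕ → Bool
    gen x = isNGen N r (N + x)
    at : ∀ i → i < N + M → inD r i ≡ lookupD (v true) false i
    at i i<N+M = eqB≡true (allB-upTo-at (λ i → eqB (inD r i) (lookupD (v true) false i)) (N + M)
      (counted⇒matchesB {N} {M} {v true} {m} r cnt) i i<N+M)
    gen-≡ : ∀ x → gen x ≡ inD r (x + N) ∧ not (inD r x)
    gen-≡ x rewrite <ᵇ-false (m≤m+n N x) | m+n∸m≡n N x | +-comm N x = refl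
    pointwise : ∀ x → x < M → + bit (lookupD (v true) false (x + N)) - + bit (lookupD (v true) false x) ≡ + bit (gen x) - + bit false
    pointwise x x<M = begin
      + bit (lookupD (v true) false (x + N)) - + bit (lookupD (v true) false x)
        ≡⟨ cong₂ (λ a b → + bit a - + bit b) (sym (at (x + N) (subst (_< N + M) (+-comm N x) (+-monoʳ-< N x<M))))
                                              (sym (at x (≤-trans x<M (m≤n+m M N)))) ⟩
      + bit (inD r (x + N)) - + bit (inD r x)
        ≡⟨ bit-implication (inD r x) (inD r (x + N)) (λ x∈r → proj₁ (validB⇒closed N M r valid x x∈r)) ⟩
      + bit (inD r (x + N) ∧ not (inD r x)) - + bit false ≡⟨ cong (λ z → + bit z - + bit false) (sym (gen-≡ x)) ⟩
      + bit (gen x) - + bit false ∎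

  summand-case₃ : lookupD u′ false N′ ≡ true → lookupD u′ false M′ ≡ true → ∀ m i j r →
    PhatSummand N M (false ∷ u′) (suc m) i j (false ∷ r)
      ≡ PhatSummand N M (v true) m i j r + onlyIf (counted N M (v true) m r) (aShift (termCoef N M r) (i - lambdaSeq N M (v true)) j)
  summand-case₃ uN uM m i j r = trans (onlyIf-cong same-counted extra-cogen) (onlyIf-+ (counted N M (v true) m r) _ _)
    where
    same-counted : counted N M (false ∷ u′) (suc m) (false ∷ r) ≡ counted N M (v true) m r
    same-counted = trans (counted-∷false m r)
      (trans (∧-eqB-forced (validB N M r) (matchesTail r) (area r ≡ᵇ m) (inD r P) (λ valid mt → P∈tail r valid mt (inj₁ uN)))
             (sym (counted-v true m r)))
    extra-cogen : counted N M (v true) m r ≡ true →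
      termCoef N M (false ∷ r) i j ≡ termCoef N M r i j + aShift (termCoef N M r) (i - lambdaSeq N M (v true)) j
    extra-cogen cnt = begin
      termCoef N M (false ∷ r) i j
        ≡⟨ termCoef-∷false r i j ⟩
      coefOf (cogenLambdas-∷false (inD r N′ ∧ inD r M′) r) (codinv N M r) i j
        ≡⟨ cong (λ b → coefOf (cogenLambdas-∷false b r) (codinv N M r) i j) cogen₀ ⟩
      coefOf (lamk N M (false ∷ r) 0 ∷ cogenLambdas N M r) (codinv N M r) i j
        ≡⟨ coefOf-∷ (lamk N M (false ∷ r) 0) (cogenLambdas N M r) (codinv N M r) i j ⟩
      coefOf (cogenLambdas N M r) (codinv N M r) i j + aShift (coefOf (cogenLambdas N M r) (codinv N M r)) (i - + lamk N M (false ∷ r) 0) j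
        ≡⟨ cong₂ (λ a λ₀ → a + aShift (coefOf (cogenLambdas N M r) (codinv N M r)) (i - λ₀) j)
                 (sym (termCoef≡coefOf N M r i j)) (lambda-v-cogen m r cnt) ⟩
      termCoef N M r i j + aShift (coefOf (cogenLambdas N M r) (codinv N M r)) (i - lambdaSeq N M (v true)) j
        ≡⟨ cong (_+_ (termCoef N M r i j)) (aShift-termCoef j) ⟩
      termCoef N M r i j + aShift (termCoef N M r) (i - lambdaSeq N M (v true)) j ∎
      where
      open ≡-Reasoning
      mt = counted-v⇒matchesTail true m r cnt
      cogen₀ : (inD r N′ ∧ inD r M′) ≡ true
      cogen₀ rewrite at-N′ r mt | at-M′ r mt | uN | uM = refl
      aShift-termCoef : ∀ j → aShift (coefOf (cogenLambdas N M r) (codinv N M r)) (i - lambdaSeq N M (v true)) j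
        ≡ aShift (termCoef N M r) (i - lambdaSeq N M (v true)) j
      aShift-termCoef zero    = refl
      aShift-termCoef (suc j) = sym (termCoef≡coefOf N M r (i - lambdaSeq N M (v true)) j)

  -- λ(u) = (gaps in [0, M)) − (gaps in [N, N + M)), read off Δ = true ∷ r.
  codinv-∷true-lambda : ∀ r → matchesTail r ≡ true → lookupD u′ false N′ ≡ true →
    + codinv N M (true ∷ r) ≡ + codinv N M r ℤ.+ lambdaSeq N M (true ∷ u′)
  codinv-∷true-lambda r mt uN = begin
    + codinv N M (true ∷ r)                    ≡⟨ move (+ codinv N M (true ∷ r)) (+ A) (+ G₀) (+ codinv N M r) codinv-ℤ ⟩
    + codinv N M r ℤ.+ (+ G₀ - + A)            ≡⟨ cong (ℤ._+_ (+ codinv N M r)) (sym lambda-gaps) ⟩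
    + codinv N M r ℤ.+ lambdaSeq N M (true ∷ u′) ∎
    where
    open ≡-Reasoning
    d = true ∷ r
    G₀ = countB (upTo M) (isGap d)
    A = countB (upTo M) (λ x → isGap d (N + x))
    move : ∀ a b c e → a ℤ.+ b ≡ c ℤ.+ e → a ≡ e ℤ.+ (c - b)
    move a b c e a+b≡c+e = trans (cancel a b) (trans (cong (_- b) a+b≡c+e) (regroup c e b))
      where
      cancel : ∀ x y → x ≡ (x ℤ.+ y) - y
      cancel = solve-∀
      regroup : ∀ x y z → (x ℤ.+ y) - z ≡ y ℤ.+ (x - z)
      regroup = solve-∀
    codinv-ℤ : + codinv N M d ℤ.+ + A ≡ + G₀ ℤ.+ + codinv N M r
    codinv-ℤ = trans (sym (ℤ.pos-+ (codinv N M d) A))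
      (trans (cong +_ (codinv-∷true r (trans (at-N′ r mt) uN))) (ℤ.pos-+ G₀ (codinv N M r)))
    at : ∀ i → i < N + M → inD d i ≡ lookupD (true ∷ u′) false i
    at zero    _             = refl
    at (suc i) (s≤s i<N′+M) = matchesTail-at r mt i i<N′+M
    lambda-gaps : lambdaSeq N M (true ∷ u′) ≡ + G₀ - + A
    lambda-gaps = sumℤ-bits _ (isGap d) (λ x → isGap d (N + x)) M λ x x<M →
      trans (cong₂ (λ a b → + bit a - + bit b)
              (sym (trans (cong (inD d) (+-comm N x)) (at (x + N) (subst (_< N + M) (+-comm N x) (+-monoʳ-< N x<M)))))
              (sym (at x (≤-trans x<M (m≤n+m M N)))))
        (bit-flip (inD d (N + x)) (inD d x))

  summand-case₄ : lookupD u′ false N′ ≡ true → lookupD u′ false M′ ≡ true → ∀ n i j r →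
    PhatSummand N M (true ∷ u′) n i j (true ∷ r) ≡ PhatSummand N M (v true) n (i - lambdaSeq N M (true ∷ u′)) j r
  summand-case₄ uN uM n i j r = onlyIf-cong same-counted shifted
    where
    same-counted : counted N M (true ∷ u′) n (true ∷ r) ≡ counted N M (v true) n r
    same-counted = begin
      counted N M (true ∷ u′) n (true ∷ r)
        ≡⟨ cong₂ _∧_ (validB-∷true r) (cong₂ _∧_ (matchesB-∷ true u′ true r) (cong (_≡ᵇ n) (area-∷true r))) ⟩
      ((inD r N′ ∧ inD r M′) ∧ validB N M r) ∧ (matchesTail r ∧ (area r ≡ᵇ n))
        ≡⟨ ∧-redundant (inD r N′ ∧ inD r M′) (validB N M r) (matchesTail r) (area r ≡ᵇ n) cogen₀ ⟩
      validB N M r ∧ (matchesTail r ∧ (area r ≡ᵇ n))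
        ≡⟨ ∧-eqB-forced (validB N M r) (matchesTail r) (area r ≡ᵇ n) (inD r P) (λ valid mt → P∈tail r valid mt (inj₁ uN)) ⟩
      validB N M r ∧ ((matchesTail r ∧ eqB (inD r P) true) ∧ (area r ≡ᵇ n))
        ≡⟨ sym (counted-v true n r) ⟩
      counted N M (v true) n r ∎
      where
      open ≡-Reasoning
      cogen₀ : matchesTail r ≡ true → (inD r N′ ∧ inD r M′) ≡ true
      cogen₀ mt rewrite at-N′ r mt | at-M′ r mt | uN | uM = refl
    shifted : counted N M (v true) n r ≡ true → termCoef N M (true ∷ r) i j ≡ termCoef N M r (i - lambdaSeq N M (true ∷ u′)) j
    shifted cnt = trans (termCoef≡coefOf N M (true ∷ r) i j)
      (trans (cong (λ ls → coefOf ls (codinv N M (true ∷ r)) i j) (cogenLambdas-∷ true r))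
        (trans (coefOf-offset (cogenLambdas N M r) (codinv N M (true ∷ r)) (codinv N M r) (lambdaSeq N M (true ∷ u′))
                  (codinv-∷true-lambda r (counted-v⇒matchesTail true n r cnt) uN) i j)
          (sym (termCoef≡coefOf N M r (i - lambdaSeq N M (true ∷ u′)) j))))

  Phat-by-tail : ∀ w m i j → Phat N M w m i j ≡ sum (map (PhatSummand N M w m i j) (allBits (N′ + m * N)))
  Phat-by-tail w m i j = Phat-allBits N M w m i j (s≤s z≤n) (N′ + m * N) (m≤n+m (m * N) N′)

  Phat-∷false : ∀ m i j → Phat N M (false ∷ u′) (suc m) i j
    ≡ sum (map (PhatSummand N M (false ∷ u′) (suc m) i j ∘ (false ∷_)) (allBits (N′ + m * N)))
  Phat-∷false m i j = trans (sum-allBits-suc (PhatSummand N M (false ∷ u′) (suc m) i j) (N′ + m * N))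
    (cong (_+ sum (map (PhatSummand N M (false ∷ u′) (suc m) i j ∘ (false ∷_)) (allBits (N′ + m * N))))
      (sum-map-zero _ (PhatSummand-∷-mismatch false u′ (suc m) i j) (allBits (N′ + m * N))))

  Phat-∷true : ∀ n i j → Phat N M (true ∷ u′) n i j ≡ sum (map (PhatSummand N M (true ∷ u′) n i j ∘ (true ∷_)) (allBits (n * N)))
  Phat-∷true n i j = trans (Phat-allBits N M (true ∷ u′) n i j (s≤s z≤n) (suc (n * N)) (n≤1+n (n * N)))
    (trans (sum-allBits-suc (PhatSummand N M (true ∷ u′) n i j) (n * N))
      (trans (cong (_+_ (sum (map (PhatSummand N M (true ∷ u′) n i j ∘ (true ∷_)) (allBits (n * N)))))
        (sum-map-zero _ (PhatSummand-∷-mismatch true u′ n i j) (allBits (n * N))))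
        (+-identityʳ _)))

  case₁ : lookupD u′ false N′ ≡ false → Phat N M (false ∷ u′) ≈S qmul (Phat N M (v true) ⊕ Phat N M (v false))
  case₁ uN zero    i j = refl
  case₁ uN (suc m) i j = begin
    Phat N M (false ∷ u′) (suc m) i j
      ≡⟨ Phat-∷false m i j ⟩
    sum (map (PhatSummand N M (false ∷ u′) (suc m) i j ∘ (false ∷_)) tails)
      ≡⟨ sum-map-cong (summand-case₁ uN m i j) tails ⟩
    sum (map (λ r → PhatSummand N M (v true) m i j r + PhatSummand N M (v false) m i j r) tails)
      ≡⟨ sum-map-+ (PhatSummand N M (v true) m i j) (PhatSummand N M (v false) m i j) tails ⟩
    sum (map (PhatSummand N M (v true) m i j) tails) + sum (map (PhatSummand N M (v false) m i j) tails)
      ≡⟨ sym (cong₂ _+_ (Phat-by-tail (v true) m i j) (Phat-by-tail (v false) m i j)) ⟩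
    Phat N M (v true) m i j + Phat N M (v false) m i j ∎
    where
    open ≡-Reasoning
    tails = allBits (N′ + m * N)

  case₂ : ExactlyOne (lookupD u′ false N′) (lookupD u′ false M′) →
    Phat N M (false ∷ u′) ≈S qmul (Phat N M (v true))
  case₂ uNM zero    i j = refl
  case₂ uNM (suc m) i j = trans (Phat-∷false m i j)
    (trans (sum-map-cong (summand-case₂ uNM m i j) (allBits (N′ + m * N))) (sym (Phat-by-tail (v true) m i j)))

  case₃ : lookupD u′ false N′ ≡ true → lookupD u′ false M′ ≡ true →
    Phat N M (false ∷ u′) ≈S qmul (Phat N M (v true) ⊕ amul (tmul (lambdaSeq N M (v true)) (Phat N M (v true))))
  case₃ uN uM zero    i j = refl
  case₃ uN uM (suc m) i j = begin
    Phat N M (false ∷ u′) (suc m) i j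
      ≡⟨ Phat-∷false m i j ⟩
    sum (map (PhatSummand N M (false ∷ u′) (suc m) i j ∘ (false ∷_)) tails)
      ≡⟨ sum-map-cong (summand-case₃ uN uM m i j) tails ⟩
    sum (map (λ r → PhatSummand N M (v true) m i j r + withCogen₀ j r) tails)
      ≡⟨ sum-map-+ (PhatSummand N M (v true) m i j) (withCogen₀ j) tails ⟩
    sum (map (PhatSummand N M (v true) m i j) tails) + sum (map (withCogen₀ j) tails)
      ≡⟨ cong₂ _+_ (sym (Phat-by-tail (v true) m i j)) (sum-withCogen₀ j) ⟩
    Phat N M (v true) m i j + amul (tmul (lambdaSeq N M (v true)) (Phat N M (v true))) m i j ∎
    where
    open ≡-Reasoning
    tails = allBits (N′ + m * N)
    withCogen₀ : ℕ → List Bool → ℕ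
    withCogen₀ j r = onlyIf (counted N M (v true) m r) (aShift (termCoef N M r) (i - lambdaSeq N M (v true)) j)
    sum-withCogen₀ : ∀ j → sum (map (withCogen₀ j) tails) ≡ amul (tmul (lambdaSeq N M (v true)) (Phat N M (v true))) m i j
    sum-withCogen₀ zero    = sum-map-zero (withCogen₀ zero) (λ r → onlyIf-zero (counted N M (v true) m r)) tails
    sum-withCogen₀ (suc j) = sym (Phat-by-tail (v true) m (i - lambdaSeq N M (v true)) j)

  case₄ : lookupD u′ false N′ ≡ true → lookupD u′ false M′ ≡ true →
    Phat N M (true ∷ u′) ≈S tmul (lambdaSeq N M (true ∷ u′)) (Phat N M (v true))
  case₄ uN uM n i j = trans (Phat-∷true n i j)
    (trans (sum-map-cong (summand-case₄ uN uM n i j) (allBits (n * N)))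
      (sym (Phat-allBits N M (v true) n (i - lambdaSeq N M (true ∷ u′)) j (s≤s z≤n) (n * N) ≤-refl)))

mainTheorem12 : (N M : ℕ) → 1 ≤ N → 1 ≤ M →
    (u : List Bool) → length u ≡ N + M → Admissible N M u →
      ((lookupD u false 0 ≡ false) → (lookupD u false N ≡ false) → (lookupD u false M ≡ false) →
        Phat N M u ≈S qmul (Phat N M (drop 1 u ++ (true ∷ [])) ⊕ Phat N M (drop 1 u ++ (false ∷ []))))
    × ((lookupD u false 0 ≡ false) →
        ((lookupD u false N ≡ true) × (lookupD u false M ≡ false)) ⊎ ((lookupD u false N ≡ false) × (lookupD u false M ≡ true)) →
        Phat N M u ≈S qmul (Phat N M (drop 1 u ++ (true ∷ []))))
    × ((lookupD u false 0 ≡ false) → (lookupD u false N ≡ true) → (lookupD u false M ≡ true) →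
        Phat N M u ≈S qmul (Phat N M (drop 1 u ++ (true ∷ []))
          ⊕ amul (tmul (lambdaSeq N M (drop 1 u ++ (true ∷ []))) (Phat N M (drop 1 u ++ (true ∷ []))))))
    × ((lookupD u false 0 ≡ true) → (lookupD u false N ≡ true) → (lookupD u false M ≡ true) →
        Phat N M u ≈S tmul (lambdaSeq N M u) (Phat N M (drop 1 u ++ (true ∷ []))))
mainTheorem12 (suc N′) (suc M′) _ _ (false ∷ u′) |u| _ =
  (λ _ uN _ → case₁ uN) , (λ _ uNM → case₂ uNM) , (λ _ uN uM → case₃ uN uM) , (λ ())
  where open FirstEntry N′ M′ u′ (suc-injective |u|)
mainTheorem12 (suc N′) (suc M′) _ _ (true ∷ u′) |u| _ =
  (λ ()) , (λ ()) , (λ ()) , (λ _ uN uM → case₄ uN uM)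
  where open FirstEntry N′ M′ u′ (suc-injective |u|)
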